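{- Let $D=(v_0,\dots,v_n)$ be any FDAG other than the FDAG $D_0$ with one vertex and no arcs. Then the following procedure (called Antecedent) applied to $D$ constructs the unique FDAG $D'$ such that $D$ is obtained from $D'$ by one application of one of the three expansion rules (branching, elongation, widening). Procedure: let $w=\mathrm{childc}(v_n)$ and $w'=\mathrm{childc}(v_{n-1})$. (a) If $v_n$ is the only vertex of height $\mathrm{height}(v_n)$: if $w$ has length $1$, delete the vertex $v_n$ (inverse of elongation); otherwise replace $w$ by $SC(w)$, i.e. remove the arc from $v_n$ to the child whose index is the last letter of $w$ (inverse of branching). (b) Otherwise: if $w$ is a minimal word of $L_<^{w'}$, delete the vertex $v_n$ (inverse of widening); otherwise replace $w$ by $SC(w)$ (inverse of branching).
   Context: A FDAG is a DAG (arcs with multiplicity allowed) obtained by DAG reduction of an irredundant forest of unordered rooted trees; equivalently, a DAG in which no two distinct vertices have the same multiset of children. The height of a vertex is $0$ for a leaf and $1+\max$ of its children's heights otherwise. A FDAG admits a unique canonical ordering $\psi$: a bijection from its vertices onto $\{0,\dots,n\}$ with $\psi(u)>\psi(v)$ whenever there is an arc $u\to v$, such that $\mathrm{height}(u)>\mathrm{height}(v)\Rightarrow \psi(u)>\psi(v)$, and for vertices of equal height, $\mathrm{childc}(u)>\mathrm{childc}(v)$ lexicographically $\Rightarrow \psi(u)>\psi(v)$. Vertices are numbered $v_i$ with $\psi(v_i)=i$, and $\mathrm{childc}(v)$ is the word formed by the indices $\psi$ of the children of $v$ (with multiplicity) sorted in decreasing order. Lexicographic order on words: compare letter by letter; if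 one word is a proper prefix of the other, the shorter is smaller; the empty word is smallest. $SC(w)$ is $w$ with its last letter removed (empty word if $w$ is empty). For the FDAG at hand, $A_<=\{0,\dots,p\}$ is the set of indices of vertices whose height is strictly less than $\mathrm{height}(v_n)$ and $A_==\{p+1,\dots,n\}$ the set of indices of vertices of the same height as $v_n$. A decreasing word on $A_<$ is a word whose letters are non-increasing; for a decreasing word $\bar w$, $L_<^{\bar w}$ is the set of decreasing words on $A_<$ that are lexicographically strictly greater than $\bar w$, and $w\in L_<^{\bar w}$ is minimal if $SC(w)\notin L_<^{\bar w}$. Expansion rules applied to a FDAG $(v_0,\dots,v_n)$ with $\mathrm{childc}(v_n)=a_0\cdots a_m$: branching adds an arc from $v_n$ to the vertex of index $a_{m+1}$, where $a_{m+1}\in A_<$ and $a_m\ge a_{m+1}$; elongation adds a new vertex $v_{n+1}$ whose only child is a vertex with index in $A_=$ (so $v_{n+1}$ is one level higher); widening adds a new vertex $v_{n+1}$ with $\mathrm{childc}(v_{n+1})$ a minimal word of $L_<^{\mathrm{childc}(v_n)}$ (so $v_{n+1}$ has the same height as $v_n$). These rules map FDAGs to FDAGs. -}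

module Defs where

open import Data.Nat using (ℕ; zero; suc; _<_; _≤_; _≥_; _>_; _⊔_; _∸_)
open import Data.List using (List; []; _∷_; _∷ʳ_; _++_; [_]; length; map; foldr; last)
open import Data.List.Relation.Unary.All using (All)
open import Data.List.Relation.Unary.Linked using (Linked)
open import Data.List.Relation.Binary.Lex.Core using (Lex-<)
open import Data.Maybe using (just)
open import Data.Product using (_×_)
open import Relation.Binary.PropositionalEquality using (_≡_; _≢_)
open import Relation.Nullary using (¬_)

-- Words on ℕ (letters are vertex indices).
Word : Set
Word = List ℕ

-- Strict lexicographic order on words (a proper prefix is smaller,
-- the empty word is smallest).
_<ₗ_ : Word → Word → Set
_<ₗ_ = Lex-< _≡_ _<_

Decreasing : Word → Set
Decreasing = Linked _≥_

SC : Word → Word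
SC []           = []
SC (x ∷ [])     = []
SC (x ∷ y ∷ ys) = x ∷ SC (y ∷ ys)

-- A FDAG is represented through its canonical ordering ψ:
-- the list (childc(v_0), …, childc(v_n)) of the words of children.
FD : Set
FD = List Word

at : {A : Set} → A → List A → ℕ → A
at d []       _       = d
at d (x ∷ xs) zero    = x
at d (x ∷ xs) (suc i) = at d xs i

childc : FD → ℕ → Word
childc D i = at [] D i

lastIdx : FD → ℕ
lastIdx D = length D ∸ 1

maxList : List ℕ → ℕ
maxList = foldr _⊔_ 0

-- heights computed in order v_0, v_1, … (children have smaller indices)
heightOf : List ℕ → Word → ℕ
heightOf hs []      = 0
heightOf hs (c ∷ w) = suc (maxList (map (at 0 hs) (c ∷ w)))

heightsFrom : List ℕ → FD → List ℕ
heightsFrom hs []       = hs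
heightsFrom hs (w ∷ ws) = heightsFrom (hs ∷ʳ heightOf hs w) ws

height : FD → ℕ → ℕ
height D i = at 0 (heightsFrom [] D) i

record IsFDAG (D : FD) : Set where
  field
    nonempty   : 0 < length D
    sorted     : ∀ i → i < length D → Decreasing (childc D i)
    arcs       : ∀ i → i < length D → All (_< i) (childc D i)
    -- no two distinct vertices have the same multiset of children
    distinct   : ∀ i j → i < length D → j < length D →
                 childc D i ≡ childc D j → i ≡ j
    heightOrd  : ∀ i j → i < length D → j < length D →
                 height D i > height D j → i > j
    lexOrd     : ∀ i j → i < length D → j < length D →
                 height D i ≡ height D j → childc D j <ₗ childc D i → i > j

D₀ : FD
D₀ = [] ∷ []

InA< : FD → ℕ → Set
InA< D a = a < length D × height D a < height D (lastIdx D)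

InA= : FD → ℕ → Set
InA= D a = a < length D × height D a ≡ height D (lastIdx D)

InL< : FD → Word → Word → Set
InL< D w̄ w = (Decreasing w × All (InA< D) w) × w̄ <ₗ w

Minimal : FD → Word → Word → Set
Minimal D w̄ w = InL< D w̄ w × ¬ InL< D w̄ (SC w)

data Expand : FD → FD → Set where
  branching  : ∀ ws w a → InA< (ws ∷ʳ w) a →
               (∀ {b} → last w ≡ just b → b ≥ a) →
               Expand (ws ∷ʳ w) (ws ∷ʳ (w ∷ʳ a))
  elongation : ∀ D a → InA= D a → Expand D (D ∷ʳ [ a ])
  widening   : ∀ D w → Minimal D (childc D (lastIdx D)) w → Expand D (D ∷ʳ w)

OnlyOfItsHeight : FD → Set
OnlyOfItsHeight D = ∀ i → i < lastIdx D → height D i ≢ height D (lastIdx D)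

-- The procedure Antecedent, as the relation "Antecedent applied to D returns D'".
-- Writing D = ws ∷ʳ w, we have w = childc(v_n), childc(v_{n-1}) = last word of ws.
data Antecedent (D : FD) : FD → Set where
  a-elong  : ∀ ws w → D ≡ ws ∷ʳ w → OnlyOfItsHeight D →
             length w ≡ 1 → Antecedent D ws
  a-branch : ∀ ws w → D ≡ ws ∷ʳ w → OnlyOfItsHeight D →
             length w ≢ 1 → Antecedent D (ws ∷ʳ SC w)
  b-widen  : ∀ ws w → D ≡ ws ∷ʳ w → ¬ OnlyOfItsHeight D →
             Minimal D (childc D (lastIdx D ∸ 1)) w → Antecedent D ws
  b-branch : ∀ ws w → D ≡ ws ∷ʳ w → ¬ OnlyOfItsHeight D →
             ¬ Minimal D (childc D (lastIdx D ∸ 1)) w → Antecedent D (ws ∷ʳ SC w)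

-- Write D = ws ∷ʳ w, so that w = childc(v_n). Branching can produce D only from
-- ws ∷ʳ SC w, elongation and widening only from ws, so it suffices to show that in
-- each case of Antecedent exactly one kind of step fits. Since the canonical order is
-- monotone in height, v_n is one level above its first (largest) child, so dropping
-- the last letter of w does not change the height of v_n.
-- If v_n is alone at its height, widening is excluded (it creates a vertex at the
-- height of v_{n-1}), and elongation fits exactly when w is a single letter.
-- Otherwise elongation would put v_n one level above v_{n-1}. If w is minimal in
-- L_<^{w'}, then ws ∷ʳ SC w is no FDAG: its canonical order would force w' < SC w,
-- i.e. SC w ∈ L_<^{w'}. If w is not minimal, SC w ∈ L_<^{w'} is lexicographically
-- above the child words of all earlier vertices of that height, so ws ∷ʳ SC w is
-- still canonically ordered, and D arises from it by branching.

module Submission where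

open import Defs
open import Data.Empty using (⊥-elim)
open import Data.List using (List; []; _∷_; _∷ʳ_; [_]; length; map; last; initLast; _∷ʳ′_)
open import Data.List.Properties using (∷ʳ-injective; length-++; map-cong-local)
open import Data.List.Relation.Unary.All as All using (All; []; _∷_; all?)
open import Data.List.Relation.Unary.All.Properties as All using (∷ʳ⁻)
open import Data.List.Relation.Unary.Linked using ([]; [-]; _∷_; linked?)
open import Data.List.Relation.Unary.Linked.Properties using (Linked⇒All)
import Data.List.Relation.Binary.Lex.Strict as Lex
open import Data.List.Relation.Binary.Pointwise using (Pointwise-≡⇒≡; ≡⇒Pointwise-≡)
open import Data.List.Reverse using (Reverse; []; _∶_∶ʳ_; reverseView)
open import Data.Maybe using (just)
open import Data.Nat
  using (ℕ; zero; suc; _+_; _∸_; _≤_; _<_; _≥_; _>_; z≤n; s≤s; z<s; _≟_; _≤?_; _<?_; >-nonZero)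
open import Data.Nat.Properties
open import Data.Product using (Σ; ∃; _×_; _,_; proj₁; proj₂)
open import Data.Sum using (_⊎_; inj₁; inj₂)
open import Function using (_∘_; flip)
open import Relation.Binary using (Transitive; Trichotomous; Decidable; tri<; tri≈; tri>)
open import Relation.Binary.PropositionalEquality
  using (_≡_; _≢_; refl; sym; trans; cong; subst; subst₂; isEquivalence; module ≡-Reasoning)
open import Relation.Nullary using (¬_; Dec; yes; no)
open import Relation.Nullary.Decidable using (_×-dec_; ¬?; decidable-stable)

-- Lists, words and the lexicographic order

length-∷ʳ : ∀ {A : Set} (xs : List A) x → length (xs ∷ʳ x) ≡ suc (length xs)
length-∷ʳ xs x = trans (length-++ xs) (+-comm (length xs) 1)

<-length-∷ʳ : ∀ {A : Set} (xs : List A) {x i} → i < length xs → i < length (xs ∷ʳ x)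
<-length-∷ʳ xs {x} p = subst (_ <_) (sym (length-∷ʳ xs x)) (m<n⇒m<1+n p)

length<length-∷ʳ : ∀ {A : Set} (xs : List A) x → length xs < length (xs ∷ʳ x)
length<length-∷ʳ xs x = subst (_ <_) (sym (length-∷ʳ xs x)) ≤-refl

index-∷ʳ : ∀ {A : Set} (xs : List A) {x i} → i < length (xs ∷ʳ x) → i < length xs ⊎ i ≡ length xs
index-∷ʳ xs {x} p = m<1+n⇒m<n∨m≡n (subst (_ <_) (length-∷ʳ xs x) p)

lastIdx-∷ʳ : ∀ (ws : FD) w → lastIdx (ws ∷ʳ w) ≡ length ws
lastIdx-∷ʳ ws w = cong (_∸ 1) (length-∷ʳ ws w)

at-∷ʳ-< : ∀ {A : Set} (d : A) xs {x i} → i < length xs → at d (xs ∷ʳ x) i ≡ at d xs i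
at-∷ʳ-< d (y ∷ xs) {i = zero}  _       = refl
at-∷ʳ-< d (y ∷ xs) {i = suc i} (s≤s p) = at-∷ʳ-< d xs p

at-∷ʳ-length : ∀ {A : Set} (d : A) xs x → at d (xs ∷ʳ x) (length xs) ≡ x
at-∷ʳ-length d []       x = refl
at-∷ʳ-length d (y ∷ xs) x = at-∷ʳ-length d xs x

SC-∷ʳ : ∀ (xs : Word) a → SC (xs ∷ʳ a) ≡ xs
SC-∷ʳ []           a = refl
SC-∷ʳ (x ∷ [])     a = refl
SC-∷ʳ (x ∷ y ∷ ys) a = cong (x ∷_) (SC-∷ʳ (y ∷ ys) a)

SC-∷ʳ-last : ∀ (xs : Word) → xs ≢ [] → ∃ λ a → xs ≡ SC xs ∷ʳ a
SC-∷ʳ-last []           xs≢[] = ⊥-elim (xs≢[] refl)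
SC-∷ʳ-last (x ∷ [])     _     = x , refl
SC-∷ʳ-last (x ∷ y ∷ ys) _     with SC-∷ʳ-last (y ∷ ys) (λ ())
... | a , eq = a , cong (x ∷_) eq

All-SC : ∀ {P : ℕ → Set} (xs : Word) → All P xs → All P (SC xs)
All-SC []           _        = []
All-SC (x ∷ [])     _        = []
All-SC (x ∷ y ∷ ys) (p ∷ ps) = p ∷ All-SC (y ∷ ys) ps

Decreasing-SC : ∀ (xs : Word) → Decreasing xs → Decreasing (SC xs)
Decreasing-SC []               _       = []
Decreasing-SC (x ∷ [])         _       = []
Decreasing-SC (x ∷ y ∷ [])     _       = [-]
Decreasing-SC (x ∷ y ∷ z ∷ zs) (r ∷ d) = r ∷ Decreasing-SC (y ∷ z ∷ zs) d

Decreasing-∷ʳ-last : ∀ (xs : Word) a {b} → Decreasing (xs ∷ʳ a) → last xs ≡ just b → b ≥ a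
Decreasing-∷ʳ-last (x ∷ [])     a (r ∷ _) refl = r
Decreasing-∷ʳ-last (x ∷ y ∷ ys) a (_ ∷ d) eq   = Decreasing-∷ʳ-last (y ∷ ys) a d eq

<ₗ-irrefl : ∀ {u} → ¬ u <ₗ u
<ₗ-irrefl = Lex.<-irreflexive (<-irrefl {_}) (≡⇒Pointwise-≡ refl)

<ₗ-trans : Transitive _<ₗ_
<ₗ-trans = Lex.<-transitive isEquivalence <-resp₂-≡ <-trans

<ₗ-asym : ∀ {u v} → u <ₗ v → ¬ v <ₗ u
<ₗ-asym p q = <ₗ-irrefl (<ₗ-trans p q)

<ₗ-cmp : Trichotomous _≡_ _<ₗ_
<ₗ-cmp u v with Lex.<-compare sym <-cmp u v
... | tri< p ¬q ¬r = tri< p (¬q ∘ ≡⇒Pointwise-≡) ¬r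
... | tri≈ ¬p q ¬r = tri≈ ¬p (Pointwise-≡⇒≡ q) ¬r
... | tri> ¬p ¬q r = tri> ¬p (¬q ∘ ≡⇒Pointwise-≡) r

_<ₗ?_ : Decidable _<ₗ_
_<ₗ?_ = Lex.<-decidable _≟_ _<?_

-- Heights

heights : FD → List ℕ
heights = heightsFrom []

heightsFrom-∷ʳ : ∀ hs ws w →
                 heightsFrom hs (ws ∷ʳ w) ≡ heightsFrom hs ws ∷ʳ heightOf (heightsFrom hs ws) w
heightsFrom-∷ʳ hs []       w = refl
heightsFrom-∷ʳ hs (v ∷ ws) w = heightsFrom-∷ʳ (hs ∷ʳ heightOf hs v) ws w

length-heightsFrom : ∀ hs ws → length (heightsFrom hs ws) ≡ length hs + length ws
length-heightsFrom hs []       = sym (+-identityʳ _)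
length-heightsFrom hs (v ∷ ws) = begin
  length (heightsFrom (hs ∷ʳ heightOf hs v) ws) ≡⟨ length-heightsFrom (hs ∷ʳ _) ws ⟩
  length (hs ∷ʳ heightOf hs v) + length ws       ≡⟨ cong (_+ length ws) (length-∷ʳ hs _) ⟩
  suc (length hs) + length ws                   ≡⟨ +-suc (length hs) (length ws) ⟨
  length hs + suc (length ws)                   ∎
  where open ≡-Reasoning

heights-∷ʳ : ∀ ws w → heights (ws ∷ʳ w) ≡ heights ws ∷ʳ heightOf (heights ws) w
heights-∷ʳ = heightsFrom-∷ʳ []

length-heights : ∀ ws → length (heights ws) ≡ length ws
length-heights = length-heightsFrom []

height-∷ʳ-< : ∀ ws {w i} → i < length ws → height (ws ∷ʳ w) i ≡ height ws i
height-∷ʳ-< ws {w} {i} p rewrite heights-∷ʳ ws w =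
  at-∷ʳ-< 0 (heights ws) (subst (i <_) (sym (length-heights ws)) p)

height-∷ʳ-length : ∀ ws w → height (ws ∷ʳ w) (length ws) ≡ heightOf (heights ws) w
height-∷ʳ-length ws w rewrite heights-∷ʳ ws w | sym (length-heights ws) =
  at-∷ʳ-length 0 (heights ws) _

childc-∷ʳ-< : ∀ (ws : FD) {w i} → i < length ws → childc (ws ∷ʳ w) i ≡ childc ws i
childc-∷ʳ-< = at-∷ʳ-< []

childc-∷ʳ-length : ∀ (ws : FD) w → childc (ws ∷ʳ w) (length ws) ≡ w
childc-∷ʳ-length = at-∷ʳ-length []

maxList-≤ : ∀ {k} {xs : List ℕ} → All (_≤ k) xs → maxList xs ≤ k
maxList-≤ []       = z≤n
maxList-≤ (p ∷ ps) = ⊔-lub p (maxList-≤ ps)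

≤-maxList : ∀ (xs : List ℕ) → All (_≤ maxList xs) xs
≤-maxList []       = []
≤-maxList (x ∷ xs) = m≤m⊔n x _ ∷ All.map (λ p → ≤-trans p (m≤n⊔m x _)) (≤-maxList xs)

<-heightOf : ∀ hs w → All (λ a → at 0 hs a < heightOf hs w) w
<-heightOf hs []      = []
<-heightOf hs (c ∷ w) = All.map s≤s (All.map⁻ (≤-maxList (map (at 0 hs) (c ∷ w))))

heightOf-≤ : ∀ hs {k} w → All (λ a → at 0 hs a < k) w → heightOf hs w ≤ k
heightOf-≤ hs []      _                    = z≤n
heightOf-≤ hs (c ∷ w) ps@(s≤s _ ∷ _) = s≤s (maxList-≤ (All.map⁺ (All.map ≤-pred ps)))

heightOf-head : ∀ hs x xs → All (λ a → at 0 hs a ≤ at 0 hs x) xs →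
                heightOf hs (x ∷ xs) ≡ suc (at 0 hs x)
heightOf-head hs x xs ps = cong suc (m≥n⇒m⊔n≡m (maxList-≤ (All.map⁺ ps)))

heightOf-∷ʳ : ∀ hs h w → All (_< length hs) w → heightOf (hs ∷ʳ h) w ≡ heightOf hs w
heightOf-∷ʳ hs h []      _  = refl
heightOf-∷ʳ hs h (c ∷ w) ps = cong (suc ∘ maxList) (map-cong-local (All.map (at-∷ʳ-< 0 hs) ps))

heightOf-heights-∷ʳ : ∀ ws w v → All (_< length ws) v →
                      heightOf (heights (ws ∷ʳ w)) v ≡ heightOf (heights ws) v
heightOf-heights-∷ʳ ws w v ps rewrite heights-∷ʳ ws w =
  heightOf-∷ʳ (heights ws) _ v (subst (λ k → All (_< k) v) (sym (length-heights ws)) ps)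

Arcs : FD → Set
Arcs D = ∀ i → i < length D → All (_< i) (childc D i)

Arcs-∷ʳ⁻ : ∀ ws {w} → Arcs (ws ∷ʳ w) → Arcs ws
Arcs-∷ʳ⁻ ws arcs i p = subst (All (_< i)) (childc-∷ʳ-< ws p) (arcs i (<-length-∷ʳ ws p))

height-childc : ∀ {D} → Arcs D → ∀ {i} → i < length D →
                height D i ≡ heightOf (heights D) (childc D i)
height-childc {D} = go (reverseView D)
  where
  go : ∀ {D} → Reverse D → Arcs D → ∀ {i} → i < length D →
       height D i ≡ heightOf (heights D) (childc D i)
  go [] _ ()
  go (ws ∶ r ∶ʳ w) arcs {i} p with index-∷ʳ ws p
  ... | inj₁ i<n = begin
    height (ws ∷ʳ w) i                                ≡⟨ height-∷ʳ-< ws i<n ⟩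
    height ws i                                       ≡⟨ go r (Arcs-∷ʳ⁻ ws arcs) i<n ⟩
    heightOf (heights ws) (childc ws i)               ≡⟨ heightOf-heights-∷ʳ ws w _ letters ⟨
    heightOf (heights (ws ∷ʳ w)) (childc ws i)        ≡⟨ cong (heightOf _) (childc-∷ʳ-< ws i<n) ⟨
    heightOf (heights (ws ∷ʳ w)) (childc (ws ∷ʳ w) i) ∎
    where
    open ≡-Reasoning
    letters : All (_< length ws) (childc ws i)
    letters = All.map (λ a<i → <-trans a<i i<n) (Arcs-∷ʳ⁻ ws arcs i i<n)
  ... | inj₂ refl = begin
    height (ws ∷ʳ w) (length ws)                                ≡⟨ height-∷ʳ-length ws w ⟩
    heightOf (heights ws) w                                     ≡⟨ heightOf-heights-∷ʳ ws w w letters ⟨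
    heightOf (heights (ws ∷ʳ w)) w                              ≡⟨ cong (heightOf _) (childc-∷ʳ-length ws w) ⟨
    heightOf (heights (ws ∷ʳ w)) (childc (ws ∷ʳ w) (length ws)) ∎
    where
    open ≡-Reasoning
    letters : All (_< length ws) w
    letters = subst (All (_< length ws)) (childc-∷ʳ-length ws w) (arcs (length ws) p)

childc≡⇒height≡ : ∀ {D} → Arcs D → ∀ {i j} → i < length D → j < length D →
                  childc D i ≡ childc D j → height D i ≡ height D j
childc≡⇒height≡ {D} arcs {i} {j} i<n j<n eq = begin
  height D i                        ≡⟨ height-childc {D} arcs i<n ⟩
  heightOf (heights D) (childc D i) ≡⟨ cong (heightOf (heights D)) eq ⟩
  heightOf (heights D) (childc D j) ≡⟨ height-childc {D} arcs j<n ⟨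
  height D j                        ∎
  where open ≡-Reasoning

-- Canonically ordered FDAGs

height-mono : ∀ {D} → IsFDAG D → ∀ {i j} → i ≤ j → j < length D → height D i ≤ height D j
height-mono fd {i} {j} i≤j j<n =
  ≮⇒≥ λ hj<hi → <⇒≱ (IsFDAG.heightOrd fd i j (≤-<-trans i≤j j<n) j<n hj<hi) i≤j

childc-<ₗ : ∀ {D} → IsFDAG D → ∀ {i j} → i < j → j < length D →
            height D i ≡ height D j → childc D i <ₗ childc D j
childc-<ₗ {D} fd {i} {j} i<j j<n hi≡hj with <ₗ-cmp (childc D i) (childc D j)
... | tri< lt _ _ = lt
... | tri≈ _ eq _ = ⊥-elim (<-irrefl (IsFDAG.distinct fd i j (<-trans i<j j<n) j<n eq) i<j)
... | tri> _ _ gt = ⊥-elim (<-asym i<j (IsFDAG.lexOrd fd i j (<-trans i<j j<n) j<n hi≡hj gt))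

childc-0 : ∀ {D} → IsFDAG D → childc D 0 ≡ []
childc-0 fd = none<0 (IsFDAG.arcs fd 0 (IsFDAG.nonempty fd))
  where
  none<0 : ∀ {xs : Word} → All (_< 0) xs → xs ≡ []
  none<0 [] = refl

leaf-index : ∀ {D} → IsFDAG D → ∀ {i} → i < length D → childc D i ≡ [] → i ≡ 0
leaf-index fd {i} i<n eq =
  IsFDAG.distinct fd i 0 i<n (IsFDAG.nonempty fd) (trans eq (sym (childc-0 fd)))

IsFDAG-∷ʳ⁻ : ∀ {ws w} → IsFDAG (ws ∷ʳ w) → 0 < length ws → IsFDAG ws
IsFDAG-∷ʳ⁻ {ws} {w} fd 0<n = record
  { nonempty  = 0<n
  ; sorted    = λ i p → subst Decreasing (childc-∷ʳ-< ws p) (sorted i (<-length-∷ʳ ws p))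
  ; arcs      = Arcs-∷ʳ⁻ ws arcs
  ; distinct  = λ i j p q eq → distinct i j (extend p) (extend q)
                  (trans (childc-∷ʳ-< ws p) (trans eq (sym (childc-∷ʳ-< ws q))))
  ; heightOrd = λ i j p q gt → heightOrd i j (extend p) (extend q)
                  (subst₂ _>_ (sym (height-∷ʳ-< ws p)) (sym (height-∷ʳ-< ws q)) gt)
  ; lexOrd    = λ i j p q eq lt → lexOrd i j (extend p) (extend q)
                  (trans (height-∷ʳ-< ws p) (trans eq (sym (height-∷ʳ-< ws q))))
                  (subst₂ _<ₗ_ (sym (childc-∷ʳ-< ws q)) (sym (childc-∷ʳ-< ws p)) lt)
  }
  where
  open IsFDAG fd
  extend : ∀ {i} → i < length ws → i < length (ws ∷ʳ w)
  extend = <-length-∷ʳ ws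

IsFDAG-replaceLast : ∀ {ws w u} → IsFDAG (ws ∷ʳ w) → Decreasing u → All (_< length ws) u →
  heightOf (heights ws) u ≡ heightOf (heights ws) w →
  (∀ j → j < length ws → height ws j ≡ heightOf (heights ws) u → childc ws j <ₗ u) →
  IsFDAG (ws ∷ʳ u)
IsFDAG-replaceLast {ws} {w} {u} fd u↘ u<n hu≡hw older<u = record
  { nonempty  = subst (0 <_) (sym (length-∷ʳ ws u)) z<s
  ; sorted    = sorted′
  ; arcs      = arcs′
  ; distinct  = distinct′
  ; heightOrd = λ i j p q gt → heightOrd i j (bound p) (bound q)
                  (subst₂ _>_ (same-height i) (same-height j) gt)
  ; lexOrd    = lexOrd′
  }
  where
  open IsFDAG fd
  n : ℕ
  n = length ws
  D′ : FD
  D′ = ws ∷ʳ u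

  bound : ∀ {i} → i < length D′ → i < length (ws ∷ʳ w)
  bound {i} p = subst (i <_) (trans (length-∷ʳ ws u) (sym (length-∷ʳ ws w))) p

  same-height : ∀ i → height D′ i ≡ height (ws ∷ʳ w) i
  same-height i = cong (λ hs → at 0 hs i)
    (trans (heights-∷ʳ ws u) (trans (cong (heights ws ∷ʳ_) hu≡hw) (sym (heights-∷ʳ ws w))))

  same-childc : ∀ {i} → i < n → childc D′ i ≡ childc (ws ∷ʳ w) i
  same-childc p = trans (childc-∷ʳ-< ws p) (sym (childc-∷ʳ-< ws p))

  last-childc : childc D′ n ≡ u
  last-childc = childc-∷ʳ-length ws u

  sorted′ : ∀ i → i < length D′ → Decreasing (childc D′ i)
  sorted′ i p with index-∷ʳ ws p
  ... | inj₁ q    = subst Decreasing (sym (same-childc q)) (sorted i (bound p))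
  ... | inj₂ refl = subst Decreasing (sym last-childc) u↘

  arcs′ : Arcs D′
  arcs′ i p with index-∷ʳ ws p
  ... | inj₁ q    = subst (All (_< i)) (sym (same-childc q)) (arcs i (bound p))
  ... | inj₂ refl = subst (All (_< n)) (sym last-childc) u<n

  older<last : ∀ {j} → j < n → height D′ j ≡ height D′ n → childc D′ j <ₗ childc D′ n
  older<last {j} q h = subst₂ _<ₗ_ (sym (childc-∷ʳ-< ws q)) (sym last-childc)
    (older<u j q (trans (sym (height-∷ʳ-< ws q)) (trans h (height-∷ʳ-length ws u))))

  older≢last : ∀ {j} → j < n → childc D′ j ≢ childc D′ n
  older≢last {j} q eq = <ₗ-irrefl (subst (_<ₗ childc D′ n) eq (older<last q
    (childc≡⇒height≡ {D′} arcs′ (<-length-∷ʳ ws q) (length<length-∷ʳ ws u) eq)))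

  distinct′ : ∀ i j → i < length D′ → j < length D′ → childc D′ i ≡ childc D′ j → i ≡ j
  distinct′ i j p q eq with index-∷ʳ ws p | index-∷ʳ ws q
  ... | inj₁ p′   | inj₁ q′   = distinct i j (bound p) (bound q)
                                  (trans (sym (same-childc p′)) (trans eq (same-childc q′)))
  ... | inj₁ p′   | inj₂ refl = ⊥-elim (older≢last p′ eq)
  ... | inj₂ refl | inj₁ q′   = ⊥-elim (older≢last q′ (sym eq))
  ... | inj₂ refl | inj₂ refl = refl

  lexOrd′ : ∀ i j → i < length D′ → j < length D′ → height D′ i ≡ height D′ j →
            childc D′ j <ₗ childc D′ i → i > j
  lexOrd′ i j p q h lt with index-∷ʳ ws p | index-∷ʳ ws q
  ... | inj₁ p′   | inj₁ q′   = lexOrd i j (bound p) (bound q)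
                                  (trans (sym (same-height i)) (trans h (same-height j)))
                                  (subst₂ _<ₗ_ (same-childc q′) (same-childc p′) lt)
  ... | inj₁ p′   | inj₂ refl = ⊥-elim (<ₗ-asym lt (older<last p′ h))
  ... | inj₂ refl | inj₁ q′   = q′
  ... | inj₂ refl | inj₂ refl = ⊥-elim (<ₗ-irrefl lt)

heightOf-decreasing : ∀ {ws} → IsFDAG ws → ∀ {x xs} → Decreasing (x ∷ xs) → x < length ws →
                      heightOf (heights ws) (x ∷ xs) ≡ suc (height ws x)
heightOf-decreasing {ws} fd {x} {xs} x↘ x<n = heightOf-head (heights ws) x xs
  (All.map (λ a≤x → height-mono fd a≤x x<n)
    (All.tail (Linked⇒All {R = _≥_} (flip ≤-trans) ≤-refl x↘)))

InL<-heightOf-≤ : ∀ {ws v u} → InL< ws v u → heightOf (heights ws) u ≤ height ws (lastIdx ws)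
InL<-heightOf-≤ {u = u} ((_ , inA) , _) = heightOf-≤ _ u (All.map proj₂ inA)

InL<-map : ∀ D E {v u} → (∀ {a} → InA< D a → InA< E a) → InL< D v u → InL< E v u
InL<-map _ _ f ((u↘ , inA) , v<u) = (u↘ , All.map f inA) , v<u

InL<? : ∀ D v u → Dec (InL< D v u)
InL<? D v u = (linked? (λ a b → b ≤? a) u ×-dec all? inA? u) ×-dec (v <ₗ? u)
  where inA? = λ a → (a <? length D) ×-dec (height D a <? height D (lastIdx D))

Minimal? : ∀ D v u → Dec (Minimal D v u)
Minimal? D v u = InL<? D v u ×-dec ¬? (InL<? D v (SC u))

data Expand⁻ (ws : FD) (w : Word) : FD → Set where
  branching  : Expand⁻ ws w (ws ∷ʳ SC w)
  elongation : ∀ {a} → w ≡ [ a ] → InA= ws a → Expand⁻ ws w ws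
  widening   : Minimal ws (childc ws (lastIdx ws)) w → Expand⁻ ws w ws

expand⁻ : ∀ {E D} → Expand E D → ∀ {ws w} → D ≡ ws ∷ʳ w → Expand⁻ ws w E
expand⁻ (branching ws w a _ _) eq with ∷ʳ-injective ws _ eq
... | refl , refl = subst (λ v → Expand⁻ ws (w ∷ʳ a) (ws ∷ʳ v)) (SC-∷ʳ w a) branching
expand⁻ (elongation D a inA) eq with ∷ʳ-injective D _ eq
... | refl , refl = elongation refl inA
expand⁻ (widening D w min) eq with ∷ʳ-injective D _ eq
... | refl , refl = widening min

IsUniquePredecessor : FD → FD → Set
IsUniquePredecessor D′ D =
  IsFDAG D′ × Expand D′ D × ((D″ : FD) → IsFDAG D″ → Expand D″ D → D″ ≡ D′)

length≡1⇒singleton : ∀ (u : Word) → length u ≡ 1 → ∃ λ a → u ≡ [ a ]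
length≡1⇒singleton (a ∷ []) _ = a , refl

SC-nonempty : ∀ (u : Word) → u ≢ [] → length u ≢ 1 → SC u ≢ []
SC-nonempty []          u≢[] _     = ⊥-elim (u≢[] refl)
SC-nonempty (x ∷ [])    _    |u|≢1 = ⊥-elim (|u|≢1 refl)
SC-nonempty (x ∷ y ∷ u) _    _     = λ ()

heightOf-SC : ∀ {ws} → IsFDAG ws → ∀ u → Decreasing u → All (_< length ws) u → SC u ≢ [] →
              heightOf (heights ws) (SC u) ≡ heightOf (heights ws) u
heightOf-SC fd (x ∷ y ∷ u) u↘ (x<n ∷ _) _ =
  trans (heightOf-decreasing fd (Decreasing-SC (x ∷ y ∷ u) u↘) x<n) (sym (heightOf-decreasing fd u↘ x<n))
heightOf-SC fd []      _ _ SC≢[] = ⊥-elim (SC≢[] refl)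
heightOf-SC fd (x ∷ []) _ _ SC≢[] = ⊥-elim (SC≢[] refl)

module LastVertex (ws : FD) (w : Word) (fd : IsFDAG (ws ∷ʳ w)) (0<n : 0 < length ws) where

  D : FD
  D = ws ∷ʳ w

  n m hm hn : ℕ
  n = length ws
  m = lastIdx ws
  hm = height ws m
  hn = heightOf (heights ws) w

  w′ : Word
  w′ = childc ws m

  len : n ≡ suc m
  len = sym (suc-pred n {{>-nonZero 0<n}})

  m<n : m < n
  m<n = subst (m <_) (sym len) ≤-refl

  <n⇒≤m : ∀ {i} → i < n → i ≤ m
  <n⇒≤m {i} p = ≤-pred (subst (i <_) len p)

  fd-ws : IsFDAG ws
  fd-ws = IsFDAG-∷ʳ⁻ fd 0<n

  lastIdx-D : lastIdx D ≡ n
  lastIdx-D = lastIdx-∷ʳ ws w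

  height-D-last : height D (lastIdx D) ≡ hn
  height-D-last rewrite lastIdx-D = height-∷ʳ-length ws w

  w′-D : childc D (lastIdx D ∸ 1) ≡ w′
  w′-D rewrite lastIdx-D = childc-∷ʳ-< ws m<n

  w↘ : Decreasing w
  w↘ = subst Decreasing (childc-∷ʳ-length ws w) (IsFDAG.sorted fd n (length<length-∷ʳ ws w))

  w<n : All (_< n) w
  w<n = subst (All (_< n)) (childc-∷ʳ-length ws w) (IsFDAG.arcs fd n (length<length-∷ʳ ws w))

  w-below : All (λ a → height ws a < hn) w
  w-below = <-heightOf (heights ws) w

  w≢[] : w ≢ []
  w≢[] w≡[] = 1+n≢0 (trans (sym len) (leaf-index fd (length<length-∷ʳ ws w)
                (trans (childc-∷ʳ-length ws w) w≡[])))

  height≤hm : ∀ {i} → i < n → height ws i ≤ hm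
  height≤hm p = height-mono fd-ws (<n⇒≤m p) m<n

  hm≤hn : hm ≤ hn
  hm≤hn = subst₂ _≤_ (height-∷ʳ-< ws m<n) (height-∷ʳ-length ws w)
            (height-mono fd (<⇒≤ m<n) (length<length-∷ʳ ws w))

  only⇒< : OnlyOfItsHeight D → hm < hn
  only⇒< only = ≤∧≢⇒< hm≤hn λ hm≡hn → only m (subst (m <_) (sym lastIdx-D) m<n)
    (trans (height-∷ʳ-< ws m<n) (trans hm≡hn (sym height-D-last)))

  <⇒only : hm < hn → OnlyOfItsHeight D
  <⇒only hm<hn i p h≡ = <⇒≢ (≤-<-trans (height≤hm i<n) hm<hn)
    (trans (sym (height-∷ʳ-< ws i<n)) (trans h≡ height-D-last))
    where
    i<n : i < n
    i<n = subst (i <_) lastIdx-D p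

  ¬only⇒≡ : ¬ OnlyOfItsHeight D → hm ≡ hn
  ¬only⇒≡ ¬only with m≤n⇒m<n∨m≡n hm≤hn
  ... | inj₁ hm<hn = ⊥-elim (¬only (<⇒only hm<hn))
  ... | inj₂ hm≡hn = hm≡hn

  InA<-D⇒ws : hm ≡ hn → ∀ {a} → InA< D a → InA< ws a
  InA<-D⇒ws hm≡hn {a} (p , lt) with index-∷ʳ ws p
  ... | inj₁ a<n  = a<n , subst₂ _<_ (height-∷ʳ-< ws a<n) (trans height-D-last (sym hm≡hn)) lt
  ... | inj₂ refl = ⊥-elim (<-irrefl (trans (height-∷ʳ-length ws w) (sym height-D-last)) lt)

  InA<-ws⇒D : ∀ {a} → InA< ws a → InA< D a
  InA<-ws⇒D {a} (a<n , lt) = <-length-∷ʳ ws a<n ,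
    subst₂ _<_ (sym (height-∷ʳ-< ws a<n)) (sym height-D-last) (<-≤-trans lt hm≤hn)

  Minimal-D⇒ws : hm ≡ hn → ∀ {u} → Minimal D (childc D (lastIdx D ∸ 1)) u → Minimal ws w′ u
  Minimal-D⇒ws hm≡hn (inL , ¬inL) rewrite w′-D =
    InL<-map D ws (InA<-D⇒ws hm≡hn) inL , ¬inL ∘ InL<-map ws D InA<-ws⇒D

  Minimal-ws⇒D : hm ≡ hn → ∀ {u} → Minimal ws w′ u → Minimal D (childc D (lastIdx D ∸ 1)) u
  Minimal-ws⇒D hm≡hn (inL , ¬inL) rewrite w′-D =
    InL<-map ws D InA<-ws⇒D inL , ¬inL ∘ InL<-map D ws (InA<-D⇒ws hm≡hn)

  hn-singleton : ∀ {a} → w ≡ [ a ] → hn ≡ suc (height ws a)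
  hn-singleton {a} w≡[a] = trans (cong (heightOf (heights ws)) w≡[a]) (heightOf-head (heights ws) a [] [])

  elongation-step : hm < hn → ∀ {a} → w ≡ [ a ] → InA= ws a
  elongation-step hm<hn {a} w≡[a] =
    a<n , ≤-antisym (height≤hm a<n) (≤-pred (subst (hm <_) (hn-singleton w≡[a]) hm<hn))
    where
    a<n : a < n
    a<n = All.head (subst (All (_< n)) w≡[a] w<n)

  no-elongation : hm ≡ hn → ∀ {a} → w ≡ [ a ] → ¬ InA= ws a
  no-elongation hm≡hn w≡[a] (_ , ha≡hm) =
    1+n≢n (sym (trans (hn-singleton w≡[a]) (cong suc (trans ha≡hm hm≡hn))))

  no-widening : hm < hn → ¬ Minimal ws w′ w
  no-widening hm<hn (inL , _) = <⇒≱ hm<hn (InL<-heightOf-≤ {ws} inL)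

  isUniquePredecessor-ws : Expand ws D → ¬ IsFDAG (ws ∷ʳ SC w) → IsUniquePredecessor ws D
  isUniquePredecessor-ws step no-branch = fd-ws , step , unique
    where
    unique : (E : FD) → IsFDAG E → Expand E D → E ≡ ws
    unique E fdE step with expand⁻ step refl
    ... | branching      = ⊥-elim (no-branch fdE)
    ... | elongation _ _ = refl
    ... | widening _     = refl

  isUniquePredecessor-SC : SC w ≢ [] → (∀ j → j < n → height ws j ≡ hn → childc ws j <ₗ SC w) →
    (∀ {a} → w ≡ [ a ] → ¬ InA= ws a) → ¬ Minimal ws w′ w →
    IsUniquePredecessor (ws ∷ʳ SC w) D
  isUniquePredecessor-SC SC≢[] older<SC no-elong no-widen = fdE , step , unique
    where
    E : FD
    E = ws ∷ʳ SC w
    hSC≡hn : heightOf (heights ws) (SC w) ≡ hn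
    hSC≡hn = heightOf-SC fd-ws w w↘ w<n SC≢[]
    fdE : IsFDAG E
    fdE = IsFDAG-replaceLast fd (Decreasing-SC w w↘) (All-SC w w<n) hSC≡hn
            (λ j j<n h≡ → older<SC j j<n (trans h≡ hSC≡hn))
    last-letter : ∃ λ a → w ≡ SC w ∷ʳ a
    last-letter = SC-∷ʳ-last w (λ w≡[] → SC≢[] (cong SC w≡[]))
    a : ℕ
    a = proj₁ last-letter
    w≡SC∷ʳa : w ≡ SC w ∷ʳ a
    w≡SC∷ʳa = proj₂ last-letter
    a<n×ha<hn : a < n × height ws a < hn
    a<n×ha<hn = proj₂ (∷ʳ⁻ (subst (All _) w≡SC∷ʳa (All.zip (w<n , w-below))))
    hE-last : height E (lastIdx E) ≡ hn
    hE-last = trans (cong (height E) (lastIdx-∷ʳ ws (SC w))) (trans (height-∷ʳ-length ws (SC w)) hSC≡hn)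
    inA : InA< E a
    inA = <-length-∷ʳ ws (proj₁ a<n×ha<hn) ,
          subst₂ _<_ (sym (height-∷ʳ-< ws (proj₁ a<n×ha<hn))) (sym hE-last) (proj₂ a<n×ha<hn)
    step : Expand E D
    step = subst (λ u → Expand E (ws ∷ʳ u)) (sym w≡SC∷ʳa)
             (branching ws (SC w) a inA (Decreasing-∷ʳ-last (SC w) a (subst Decreasing w≡SC∷ʳa w↘)))
    unique : (E′ : FD) → IsFDAG E′ → Expand E′ D → E′ ≡ E
    unique E′ _ step′ with expand⁻ step′ refl
    ... | branching            = refl
    ... | elongation w≡[a] inA= = ⊥-elim (no-elong w≡[a] inA=)
    ... | widening min         = ⊥-elim (no-widen min)

  a-elong-correct : hm < hn → length w ≡ 1 → IsUniquePredecessor ws D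
  a-elong-correct hm<hn |w|≡1 with length≡1⇒singleton w |w|≡1
  ... | a , w≡[a] = isUniquePredecessor-ws step no-branch
    where
    step : Expand ws D
    step = subst (λ u → Expand ws (ws ∷ʳ u)) (sym w≡[a]) (elongation ws a (elongation-step hm<hn w≡[a]))
    no-branch : ¬ IsFDAG (ws ∷ʳ SC w)
    no-branch fdE = 1+n≢0 (trans (sym len) (leaf-index fdE (length<length-∷ʳ ws (SC w))
                      (trans (childc-∷ʳ-length ws (SC w)) (cong SC w≡[a]))))

  a-branch-correct : hm < hn → length w ≢ 1 → IsUniquePredecessor (ws ∷ʳ SC w) D
  a-branch-correct hm<hn |w|≢1 =
    isUniquePredecessor-SC (SC-nonempty w w≢[] |w|≢1)
      (λ j j<n hj≡hn → ⊥-elim (<⇒≢ (≤-<-trans (height≤hm j<n) hm<hn) hj≡hn))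
      (λ w≡[a] _ → |w|≢1 (cong length w≡[a]))
      (no-widening hm<hn)

  b-widen-correct : hm ≡ hn → Minimal D (childc D (lastIdx D ∸ 1)) w → IsUniquePredecessor ws D
  b-widen-correct hm≡hn min = isUniquePredecessor-ws (widening ws w min-ws) no-branch
    where
    min-ws : Minimal ws w′ w
    min-ws = Minimal-D⇒ws hm≡hn min
    no-branch : ¬ IsFDAG (ws ∷ʳ SC w)
    no-branch fdE = proj₂ min-ws ((Decreasing-SC w w↘ , SC-below) , w′<SC)
      where
      SC-below : All (InA< ws) (SC w)
      SC-below = All-SC w (proj₂ (proj₁ (proj₁ min-ws)))
      hm≡hSC : height (ws ∷ʳ SC w) m ≡ height (ws ∷ʳ SC w) n
      hm≡hSC = ≤-antisym (height-mono fdE (<⇒≤ m<n) (length<length-∷ʳ ws (SC w)))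
        (subst₂ _≤_ (sym (height-∷ʳ-length ws (SC w))) (sym (height-∷ʳ-< ws m<n))
          (heightOf-≤ (heights ws) (SC w) (All.map proj₂ SC-below)))
      w′<SC : w′ <ₗ SC w
      w′<SC = subst₂ _<ₗ_ (childc-∷ʳ-< ws m<n) (childc-∷ʳ-length ws (SC w))
                (childc-<ₗ fdE m<n (length<length-∷ʳ ws (SC w)) hm≡hSC)

  b-branch-correct : hm ≡ hn → ¬ Minimal D (childc D (lastIdx D ∸ 1)) w →
                         IsUniquePredecessor (ws ∷ʳ SC w) D
  b-branch-correct hm≡hn ¬min =
    isUniquePredecessor-SC (λ SC≡[] → Lex.xs≮[] (subst (w′ <ₗ_) SC≡[] w′<SC)) older<SC
      (no-elongation hm≡hn) ¬min-ws
    where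
    ¬min-ws : ¬ Minimal ws w′ w
    ¬min-ws = ¬min ∘ Minimal-ws⇒D hm≡hn
    w′<w : w′ <ₗ w
    w′<w = subst₂ _<ₗ_ (childc-∷ʳ-< ws m<n) (childc-∷ʳ-length ws w)
             (childc-<ₗ fd m<n (length<length-∷ʳ ws w)
               (trans (height-∷ʳ-< ws m<n) (trans hm≡hn (sym (height-∷ʳ-length ws w)))))
    w∈L : InL< ws w′ w
    w∈L = (w↘ , All.zipWith (λ (a<n , ha<hn) → a<n , subst (_ <_) (sym hm≡hn) ha<hn) (w<n , w-below))
        , w′<w
    w′<SC : w′ <ₗ SC w
    w′<SC = proj₂ (decidable-stable (InL<? ws w′ (SC w)) (λ ¬SC∈L → ¬min-ws (w∈L , ¬SC∈L)))
    older<SC : ∀ j → j < n → height ws j ≡ hn → childc ws j <ₗ SC w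
    older<SC j j<n hj≡hn with m<1+n⇒m<n∨m≡n (subst (j <_) len j<n)
    ... | inj₁ j<m  = <ₗ-trans (childc-<ₗ fd-ws j<m m<n (trans hj≡hn (sym hm≡hn))) w′<SC
    ... | inj₂ refl = w′<SC

  antecedent : Σ FD (Antecedent D)
  antecedent with hm <? hn | length w ≟ 1 | Minimal? D (childc D (lastIdx D ∸ 1)) w
  ... | yes hm<hn | yes |w|≡1 | _       = ws , a-elong ws w refl (<⇒only hm<hn) |w|≡1
  ... | yes hm<hn | no |w|≢1  | _       = ws ∷ʳ SC w , a-branch ws w refl (<⇒only hm<hn) |w|≢1
  ... | no hm≮hn  | _         | yes min = ws , b-widen ws w refl (hm≮hn ∘ only⇒<) min
  ... | no hm≮hn  | _         | no ¬min = ws ∷ʳ SC w , b-branch ws w refl (hm≮hn ∘ only⇒<) ¬min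

  antecedent-correct : (D′ : FD) → Antecedent D D′ → IsUniquePredecessor D′ D
  antecedent-correct _ (a-elong ws₁ w₁ eq only |w|≡1) with ∷ʳ-injective ws ws₁ eq
  ... | refl , refl = a-elong-correct (only⇒< only) |w|≡1
  antecedent-correct _ (a-branch ws₁ w₁ eq only |w|≢1) with ∷ʳ-injective ws ws₁ eq
  ... | refl , refl = a-branch-correct (only⇒< only) |w|≢1
  antecedent-correct _ (b-widen ws₁ w₁ eq ¬only min) with ∷ʳ-injective ws ws₁ eq
  ... | refl , refl = b-widen-correct (¬only⇒≡ ¬only) min
  antecedent-correct _ (b-branch ws₁ w₁ eq ¬only ¬min) with ∷ʳ-injective ws ws₁ eq
  ... | refl , refl = b-branch-correct (¬only⇒≡ ¬only) ¬min

proposition2p11 : (D : FD) → IsFDAG D → D ≢ D₀ →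
    Σ FD (Antecedent D) ×
    ((D' : FD) → Antecedent D D' →
      IsFDAG D' × Expand D' D ×
      ((D'' : FD) → IsFDAG D'' → Expand D'' D → D'' ≡ D'))
proposition2p11 D fd D≢D₀ with initLast D
... | []               = ⊥-elim (<-irrefl refl (IsFDAG.nonempty fd))
... | [] ∷ʳ′ w         = ⊥-elim (D≢D₀ (cong [_] (childc-0 fd)))
... | (v ∷ ws) ∷ʳ′ w   = antecedent , antecedent-correct
  where open LastVertex (v ∷ ws) w fd z<s
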